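{- Let $p$ be a prime number. Any $p$-adic Liouville number $\xi$ satisfies $\widehat{\mu}^{\times}(\xi) \leq 3$.
   Context: $|\cdot|_p$ is the $p$-adic absolute value with $|p|_p=p^{ -1}$. A $p$-adic Liouville number is an irrational $p$-adic number $\xi$ with $\mu(\xi)=\infty$, where $\mu(\xi)$ is the supremum of the real $\mu$ for which $0 < |y\xi - x|_p \le \max\{|x|,|y|\}^{ -\mu}$ has infinitely many solutions in nonzero integers $x,y$. $\widehat{\mu}^{\times}(\xi)$ is the supremum of the real numbers $\widehat{\mu}^\times$ such that for every sufficiently large real $X$ the system $0 < |xy|^{1/2} \le X$, $|y\xi - x|_p \le X^{ -\widehat{\mu}^\times}$ has a solution in integers $x,y$. -}

module Defs where

open import Data.Nat as ℕ using (ℕ; zero; suc; _<_; _≤_; _⊔_)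
open import Data.Integer as ℤ using (ℤ; +_; ∣_∣)
open import Data.Integer.Divisibility using () renaming (_∣_ to _∣ℤ_)
open import Data.Product using (Σ; ∃; ∃-syntax; _×_; _,_)
open import Data.List using (List)
open import Data.List.Membership.Propositional using (_∉_)
open import Relation.Nullary using (¬_)
open import Relation.Binary.PropositionalEquality using (_≢_)

-- A p-adic number ξ = p^(-shift) * Σ_{n ≥ 0} digit n * p^n,  0 ≤ digit n < p.
-- Every element of ℚ_p has such a representation.
record Qp (p : ℕ) : Set where
  field
    shift   : ℕ
    digit   : ℕ → ℕ
    digit<p : ∀ n → digit n < p
open Qp public

-- residue ξ m = Σ_{n<m} digit n * p^n  (the p-adic integer p^shift ξ modulo p^m)
residue : ∀ {p} → Qp p → ℕ → ℕ
residue ξ zero    = 0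
residue {p} ξ (suc m) = residue ξ m ℕ.+ digit ξ m ℕ.* p ℕ.^ m

-- ValGe ξ x y v  :⇔  |y ξ - x|_p ≤ p^(-v)
-- (since y ξ - x = p^(-k) (y A - x p^k) with A = p^k ξ ∈ ℤ_p, k = shift ξ)
ValGe : ∀ {p} → Qp p → ℤ → ℤ → ℕ → Set
ValGe {p} ξ x y v =
  (+ (p ℕ.^ (v ℕ.+ shift ξ))) ∣ℤ
    (y ℤ.* + residue ξ (v ℕ.+ shift ξ) ℤ.- x ℤ.* + (p ℕ.^ shift ξ))

DiffZero : ∀ {p} → Qp p → ℤ → ℤ → Set
DiffZero ξ x y = ∀ v → ValGe ξ x y v

DiffNonzero : ∀ {p} → Qp p → ℤ → ℤ → Set
DiffNonzero ξ x y = ¬ DiffZero ξ x y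

-- PadicLe ξ x y N D a b  :⇔  |y ξ - x|_p ≤ (N/D)^(-a/b), intended for N/D ≥ 1
-- (then the bound is ≤ 1, so |yξ-x|_p ≤ B iff ∃ v ∈ ℕ with val ≥ v and p^(-v) ≤ B,
--  i.e. (N/D)^a ≤ p^(v b)).
PadicLe : ∀ {p} → Qp p → ℤ → ℤ → ℕ → ℕ → ℕ → ℕ → Set
PadicLe {p} ξ x y N D a b =
  ∃[ v ] ((N ℕ.^ a ≤ p ℕ.^ (v ℕ.* b) ℕ.* D ℕ.^ a) × ValGe ξ x y v)

Irrational : ∀ {p} → Qp p → Set
Irrational ξ = ∀ (x y : ℤ) → y ≢ + 0 → ¬ DiffZero ξ x y

LiouvilleSol : ∀ {p} → Qp p → ℕ → ℤ → ℤ → Set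
LiouvilleSol ξ μ x y =
  x ≢ + 0 × y ≢ + 0 × DiffNonzero ξ x y × PadicLe ξ x y (∣ x ∣ ⊔ ∣ y ∣) 1 μ 1

InfinitelyManySol : ∀ {p} → Qp p → ℕ → Set
InfinitelyManySol ξ μ =
  ∀ (L : List (ℤ × ℤ)) → ∃[ x ] ∃[ y ] ((x , y) ∉ L × LiouvilleSol ξ μ x y)

-- μ(ξ) = ∞ (the solution sets decrease in μ, so natural μ suffices), ξ irrational
PadicLiouville : ∀ {p} → Qp p → Set
PadicLiouville ξ = Irrational ξ × (∀ (μ : ℕ) → InfinitelyManySol ξ μ)

-- HatMuTimesAdmissible ξ c d : the exponent μ̂ = c/d belongs to the set whose
-- supremum defines μ̂^×(ξ): for every sufficiently large X = N/D (X ≥ X₀, X ≥ 1)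
-- there are integers x, y with 0 < |xy|^(1/2) ≤ X and |y ξ - x|_p ≤ X^(-c/d).
HatMuTimesAdmissible : ∀ {p} → Qp p → ℕ → ℕ → Set
HatMuTimesAdmissible ξ c d =
  ∃[ X₀ ] ∀ (N D : ℕ) → X₀ ℕ.* suc D ≤ N → suc D ≤ N →
    ∃[ x ] ∃[ y ] ((0 < ∣ x ℤ.* y ∣)
                  × (∣ x ℤ.* y ∣ ℕ.* (suc D ℕ.^ 2) ≤ N ℕ.^ 2)
                  × PadicLe ξ x y N (suc D) c d)

{-# OPTIONS --safe #-}
module Submission where

-- Take a Liouville approximation b ξ ≈ a of height H = max (|a|, |b|) whose exact
-- p-adic valuation w is so large that H ^ μ ≤ p ^ w, and test admissibility at the scale
-- X = p ^ K with K ≈ w d / (2d + 1).  It provides (x, y) with |xy| ≤ p ^ 2K and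
-- valuation of y ξ − x at least K c / d > w + K, since c > 3d.  If (x, y) is not
-- proportional to (a, b), then p ^ w divides a y − x b ≠ 0, whence
-- p ^ w ≤ 2 H |xy| ≤ 2 H p ^ 2K, which the choice of K forbids.  If it is proportional,
-- the exact valuation w of (a, b) forces p ^ (K + 1) to divide both x and y, so
-- |xy| > p ^ 2K.

open import Defs
open import Data.Nat
open import Data.Nat.Properties
open import Data.Nat.Divisibility
open import Data.Nat.DivMod using (_/_; _%_; m≡m%n+[m/n]*n; m%n<n; m/n*n≤m)
open import Data.Nat.Primality using (Prime; euclidsLemma; prime⇒nonZero; prime⇒nonTrivial)
open import Data.Nat.Tactic.RingSolver using (solve-∀)
open import Data.Integer as ℤ using (ℤ; +_; ∣_∣; -[1+_])
open import Data.Integer.Divisibility using () renaming (_∣_ to _∣ℤ_)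
import Data.Integer.Properties as ℤ
import Data.Integer.Divisibility.Signed as ℤ
import Data.Integer.Tactic.RingSolver as ℤ
open import Data.Product using (∃-syntax; _×_; _,_; proj₁; proj₂)
open import Data.Sum using (inj₁; inj₂)
open import Data.Empty using (⊥-elim)
open import Data.List using (List; _∷_; [])
open import Data.List.Membership.Propositional using (_∉_)
open import Data.List.Relation.Unary.Any using (here; there)
open import Function using (_⇔_; mk⇔; Equivalence)
open import Relation.Nullary using (¬_; yes; no; Dec)
open import Relation.Binary.PropositionalEquality

^-monoʳ-∣ : ∀ m {i j} → i ≤ j → m ^ i ∣ m ^ j
^-monoʳ-∣ m {i} {j} i≤j =
  subst (m ^ i ∣_) (trans (sym (^-distribˡ-+-* m i (j ∸ i))) (cong (m ^_) (m+[n∸m]≡n i≤j)))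
        (m∣m*n (m ^ (j ∸ i)))

∣⇔∣+multiple : ∀ (k i j : ℤ) → k ∣ℤ i ⇔ k ∣ℤ i ℤ.+ j ℤ.* k
∣⇔∣+multiple k i j = mk⇔
  (λ k∣i → ℤ.∣⇒∣ᵤ (ℤ.∣m∣n⇒∣m+n (ℤ.∣ᵤ⇒∣ {k} {i} k∣i) k∣jk))
  (λ k∣i+jk → ℤ.∣⇒∣ᵤ {k} {i} (ℤ.∣m+n∣n⇒∣m (ℤ.∣ᵤ⇒∣ {k} {i ℤ.+ j ℤ.* k} k∣i+jk) k∣jk))
  where
  k∣jk : k ℤ.∣ j ℤ.* k
  k∣jk = ℤ.∣n⇒∣m*n j ℤ.∣-refl

^-distribʳ-* : ∀ m n o → (m * n) ^ o ≡ m ^ o * n ^ o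
^-distribʳ-* m n zero    = refl
^-distribʳ-* m n (suc o) =
  trans (cong (m * n *_) (^-distribʳ-* m n o)) (interchange m n (m ^ o) (n ^ o))
  where
  interchange : ∀ m n a b → m * n * (a * b) ≡ m * a * (n * b)
  interchange = solve-∀

n<m^n : ∀ {m} → 1 < m → ∀ n → n < m ^ n
n<m^n 1<m zero    = s≤s z≤n
n<m^n {m} 1<m (suc n) = begin-strict
  suc n          <⟨ +-mono-≤ (m<n⇒0<n ih) ih ⟩
  m ^ n + m ^ n  ≡⟨ cong (_+_ (m ^ n)) (+-identityʳ (m ^ n)) ⟨
  2 * m ^ n      ≤⟨ *-monoˡ-≤ (m ^ n) 1<m ⟩
  m ^ suc n      ∎
  where
  open ≤-Reasoning
  ih : n < m ^ n
  ih = n<m^n 1<m n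

^-cancelˡ-≤ : ∀ {m} → 1 < m → ∀ {i j} → m ^ i ≤ m ^ j → i ≤ j
^-cancelˡ-≤ {m} 1<m m^i≤m^j = ≮⇒≥ (λ j<i → <⇒≱ (^-monoʳ-< m 1<m j<i) m^i≤m^j)

^-cancelʳ-< : ∀ n {a b} → a ^ n < b ^ n → a < b
^-cancelʳ-< n a^n<b^n = ≰⇒> (λ b≤a → <⇒≱ a^n<b^n (^-monoˡ-≤ n b≤a))

module _ {p : ℕ} (p-prime : Prime p) where

  private instance
    p≢0 : NonZero p
    p≢0 = prime⇒nonZero p-prime

  p^j∣m*n⇒p^j∣m : ∀ {n} → ¬ p ∣ n → ∀ j m → p ^ j ∣ m * n → p ^ j ∣ m
  p^j∣m*n⇒p^j∣m p∤n zero m _ = 1∣ m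
  p^j∣m*n⇒p^j∣m {n} p∤n (suc j) m p^[1+j]∣mn
    with euclidsLemma m n p-prime (m*n∣⇒m∣ p (p ^ j) p^[1+j]∣mn)
  ... | inj₂ p∣n = ⊥-elim (p∤n p∣n)
  ... | inj₁ (divides-refl m′) = subst (p ^ suc j ∣_) (*-comm p m′) (*-monoʳ-∣ p p^j∣m′)
    where
    shuffle : ∀ m′ p n → m′ * p * n ≡ p * (m′ * n)
    shuffle = solve-∀
    p^j∣m′ : p ^ j ∣ m′
    p^j∣m′ = p^j∣m*n⇒p^j∣m p∤n j m′
      (*-cancelˡ-∣ p (subst (p ^ suc j ∣_) (shuffle m′ p n) p^[1+j]∣mn))

  p^[k+j]∣m*n⇒p^j∣m : ∀ k j m {n} → p ^ k ∣ n → ¬ p ^ suc k ∣ n → p ^ (k + j) ∣ m * n → p ^ j ∣ m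
  p^[k+j]∣m*n⇒p^j∣m k j m {n} (divides-refl n′) p^[1+k]∤n p^[k+j]∣mn =
    p^j∣m*n⇒p^j∣m p∤n′ j m (*-cancelˡ-∣ (p ^ k) {{m^n≢0 p k}}
      (subst₂ _∣_ (^-distribˡ-+-* p k j) (shuffle m n′ (p ^ k)) p^[k+j]∣mn))
    where
    p∤n′ : ¬ p ∣ n′
    p∤n′ (divides-refl n″) = p^[1+k]∤n (divides n″ (*-assoc n″ p (p ^ k)))
    shuffle : ∀ m n′ P → m * (n′ * P) ≡ P * (m * n′)
    shuffle = solve-∀

module _ {p : ℕ} (ξ : Qp p) where

  residue-+ : ∀ m n → ∃[ q ] residue ξ (m + n) ≡ residue ξ m + q * p ^ m
  residue-+ m zero rewrite +-identityʳ m = 0 , sym (+-identityʳ _)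
  residue-+ m (suc n) rewrite +-suc m n with residue-+ m n
  ... | q , eq = q + dₘₙ * p ^ n , (begin
      residue ξ (m + n) + dₘₙ * p ^ (m + n)
        ≡⟨ cong₂ _+_ eq (cong (dₘₙ *_) (^-distribˡ-+-* p m n)) ⟩
      residue ξ m + q * p ^ m + dₘₙ * (p ^ m * p ^ n)
        ≡⟨ regroup (residue ξ m) q (p ^ m) dₘₙ (p ^ n) ⟩
      residue ξ m + (q + dₘₙ * p ^ n) * p ^ m ∎)
    where
    open ≡-Reasoning
    dₘₙ : ℕ
    dₘₙ = digit ξ (m + n)
    regroup : ∀ r q P d Q → r + q * P + d * (P * Q) ≡ r + (q + d * Q) * P
    regroup = solve-∀

  -- p ^ shift ξ · (y ξ − x) modulo p ^ M; by definition ValGe ξ x y v is the divisibility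
  -- of defect x y (v + shift ξ) by p ^ (v + shift ξ).
  defect : ℤ → ℤ → ℕ → ℤ
  defect x y M = y ℤ.* + residue ξ M ℤ.- x ℤ.* + (p ^ shift ξ)

  defect-+ : ∀ x y m n → ∃[ q ] defect x y (m + n) ≡ defect x y m ℤ.+ q ℤ.* + (p ^ m)
  defect-+ x y m n with residue-+ m n
  ... | q , eq = y ℤ.* + q , (begin
      y ℤ.* + residue ξ (m + n) ℤ.- x ℤ.* S
        ≡⟨ cong (λ r → y ℤ.* r ℤ.- x ℤ.* S) (trans (cong +_ eq) (ℤ.pos-+ _ (q * p ^ m))) ⟩
      y ℤ.* (+ residue ξ m ℤ.+ + (q * p ^ m)) ℤ.- x ℤ.* S
        ≡⟨ cong (λ t → y ℤ.* (+ residue ξ m ℤ.+ t) ℤ.- x ℤ.* S) (ℤ.pos-* q (p ^ m)) ⟩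
      y ℤ.* (+ residue ξ m ℤ.+ + q ℤ.* + (p ^ m)) ℤ.- x ℤ.* S
        ≡⟨ regroup y (+ residue ξ m) (+ q) (+ (p ^ m)) x S ⟩
      defect x y m ℤ.+ y ℤ.* + q ℤ.* + (p ^ m) ∎)
    where
    open ≡-Reasoning
    S : ℤ
    S = + (p ^ shift ξ)
    regroup : ∀ (y R q P x S : ℤ) →
      y ℤ.* (R ℤ.+ q ℤ.* P) ℤ.- x ℤ.* S ≡ (y ℤ.* R ℤ.- x ℤ.* S) ℤ.+ y ℤ.* q ℤ.* P
    regroup = ℤ.solve-∀

  ValGe⇔∣defect : ∀ x y {v M} → v + shift ξ ≤ M →
    ValGe ξ x y v ⇔ + (p ^ (v + shift ξ)) ∣ℤ defect x y M
  ValGe⇔∣defect x y {v} {M} le =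
    subst (λ N → ValGe ξ x y v ⇔ P ∣ℤ defect x y N) (m+[n∸m]≡n le)
      (subst (λ t → ValGe ξ x y v ⇔ P ∣ℤ t) (sym (proj₂ expansion))
        (∣⇔∣+multiple P (defect x y (v + shift ξ)) (proj₁ expansion)))
    where
    P : ℤ
    P = + (p ^ (v + shift ξ))
    expansion : ∃[ q ] defect x y (v + shift ξ + (M ∸ (v + shift ξ)))
                         ≡ defect x y (v + shift ξ) ℤ.+ q ℤ.* P
    expansion = defect-+ x y (v + shift ξ) (M ∸ (v + shift ξ))

  ValGe-mono : ∀ x y {u v} → u ≤ v → ValGe ξ x y v → ValGe ξ x y u
  ValGe-mono x y {u} {v} u≤v h =
    Equivalence.from (ValGe⇔∣defect x y u+s≤v+s) (∣-trans (^-monoʳ-∣ p u+s≤v+s) h)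
    where
    u+s≤v+s : u + shift ξ ≤ v + shift ξ
    u+s≤v+s = +-monoˡ-≤ (shift ξ) u≤v

  ValGe? : ∀ x y v → Dec (ValGe ξ x y v)
  ValGe? x y v = p ^ (v + shift ξ) ∣? ∣ defect x y (v + shift ξ) ∣

  -- The exact valuation is found by an unbounded search, so only its existence up to
  -- double negation is constructive; this suffices since the goal is ⊥.
  exact-valuation : ∀ {x y v₀} → ValGe ξ x y v₀ → DiffNonzero ξ x y →
    ¬ ¬ (∃[ w ] (v₀ ≤ w × ValGe ξ x y w × ¬ ValGe ξ x y (suc w)))
  exact-valuation {x} {y} {v₀} h₀ yξ≢x no-exact =
    yξ≢x λ v → ValGe-mono x y (m≤n+m v v₀) (above v)
    where
    above : ∀ n → ValGe ξ x y (v₀ + n)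
    above zero = subst (ValGe ξ x y) (sym (+-identityʳ v₀)) h₀
    above (suc n) with ValGe? x y (suc (v₀ + n))
    ... | yes h = subst (ValGe ξ x y) (sym (+-suc v₀ n)) h
    ... | no ¬h = ⊥-elim (no-exact (v₀ + n , m≤m+n v₀ n , above n , ¬h))

  PadicLe₁⇒ : ∀ {x y N a b} → PadicLe ξ x y N 1 a b → ∃[ v ] (N ^ a ≤ p ^ (v * b) × ValGe ξ x y v)
  PadicLe₁⇒ {N = N} {a} {b} (v , N^a≤ , h) =
    v , subst (N ^ a ≤_) (trans (cong (p ^ (v * b) *_) (^-zeroˡ a)) (*-identityʳ _)) N^a≤ , h

  LiouvilleSol⇒exact-valuation : .{{NonZero p}} → ∀ μ x y → LiouvilleSol ξ μ x y →
    ¬ ¬ (∃[ w ] ((∣ x ∣ ⊔ ∣ y ∣) ^ μ ≤ p ^ w × ValGe ξ x y w × ¬ ValGe ξ x y (suc w)))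
  LiouvilleSol⇒exact-valuation μ x y (_ , _ , yξ≢x , approx) no-exact
    with PadicLe₁⇒ {x} {y} {∣ x ∣ ⊔ ∣ y ∣} {μ} {1} approx
  ... | v₀ , H^μ≤p^v₀ , h₀ = exact-valuation {x} {y} h₀ yξ≢x λ (w , v₀≤w , hw , ¬hw) →
    no-exact (w , ≤-trans H^μ≤p^v₀ (^-monoʳ-≤ p (v₀*1≤ v₀≤w)) , hw , ¬hw)
    where
    v₀*1≤ : ∀ {w} → v₀ ≤ w → v₀ * 1 ≤ w
    v₀*1≤ = ≤-trans (≤-reflexive (*-identityʳ v₀))

  PadicLe-p^K⇒ValGe : 1 < p → ∀ x y K c d w → PadicLe ξ x y (p ^ K) 1 c d →
    w * d + K * d < K * c → ValGe ξ x y (w + suc K)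
  PadicLe-p^K⇒ValGe 1<p x y K c d w approx excess
    with PadicLe₁⇒ {x} {y} {p ^ K} {c} {d} approx
  ... | v , p^Kc≤p^vd , h = ValGe-mono x y (≤-trans (≤-reflexive (+-suc w K)) w+K<v) h
    where
    open ≤-Reasoning
    Kc≤vd : K * c ≤ v * d
    Kc≤vd = ^-cancelˡ-≤ 1<p (subst (_≤ p ^ (v * d)) (^-*-assoc p K c) p^Kc≤p^vd)
    w+K<v : w + K < v
    w+K<v = *-cancelʳ-< d (w + K) v (begin-strict
      (w + K) * d      ≡⟨ *-distribʳ-+ d w K ⟩
      w * d + K * d    <⟨ excess ⟩
      K * c            ≤⟨ Kc≤vd ⟩
      v * d            ∎)

  admissible-at-p^K : 1 < p → ∀ {c d} (adm : HatMuTimesAdmissible ξ c d) K w →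
    proj₁ adm ≤ p ^ K → w * d + K * d < K * c →
    ∃[ x ] ∃[ y ] (0 < ∣ x ℤ.* y ∣ × ∣ x ℤ.* y ∣ ≤ p ^ K * p ^ K × ValGe ξ x y (w + suc K))
  admissible-at-p^K 1<p {c} {d} (X₀ , adm) K w X₀≤p^K excess
    with adm (p ^ K) 0 (≤-trans (≤-reflexive (*-identityʳ X₀)) X₀≤p^K)
             (m^n>0 p {{>-nonZero (<-trans z<s 1<p)}} K)
  ... | x , y , 0<xy , xy≤p^2K , approx =
    x , y , 0<xy , subst₂ _≤_ (*-identityʳ _) (cong (p ^ K *_) (*-identityʳ (p ^ K))) xy≤p^2K ,
    PadicLe-p^K⇒ValGe 1<p x y K c d w approx excess

  cross-defect : ∀ a b x y M →
    b ℤ.* defect x y M ℤ.- y ℤ.* defect a b M ≡ + (p ^ shift ξ) ℤ.* (a ℤ.* y ℤ.- x ℤ.* b)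
  cross-defect a b x y M = identity a b x y (+ residue ξ M) (+ (p ^ shift ξ))
    where
    identity : ∀ (a b x y R S : ℤ) →
      b ℤ.* (y ℤ.* R ℤ.- x ℤ.* S) ℤ.- y ℤ.* (b ℤ.* R ℤ.- a ℤ.* S) ≡ S ℤ.* (a ℤ.* y ℤ.- x ℤ.* b)
    identity = ℤ.solve-∀

  cross-defect′ : ∀ a b x y M →
    a ℤ.* defect x y M ℤ.- x ℤ.* defect a b M ≡ + residue ξ M ℤ.* (a ℤ.* y ℤ.- x ℤ.* b)
  cross-defect′ a b x y M = identity a b x y (+ residue ξ M) (+ (p ^ shift ξ))
    where
    identity : ∀ (a b x y R S : ℤ) →
      a ℤ.* (y ℤ.* R ℤ.- x ℤ.* S) ℤ.- x ℤ.* (b ℤ.* R ℤ.- a ℤ.* S) ≡ R ℤ.* (a ℤ.* y ℤ.- x ℤ.* b)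
    identity = ℤ.solve-∀

  ValGe⇒p^v∣cross : .{{NonZero p}} → ∀ a b x y {v} → ValGe ξ a b v → ValGe ξ x y v →
    p ^ v ∣ ∣ a ℤ.* y ℤ.- x ℤ.* b ∣
  ValGe⇒p^v∣cross a b x y {v} hab hxy =
    *-cancelˡ-∣ (p ^ shift ξ) {{m^n≢0 p (shift ξ)}}
      (subst₂ _∣_ (trans (^-distribˡ-+-* p v (shift ξ)) (*-comm (p ^ v) (p ^ shift ξ)))
                  (ℤ.abs-* (+ (p ^ shift ξ)) (a ℤ.* y ℤ.- x ℤ.* b))
                  (subst (λ t → P ∣ℤ t) (cross-defect a b x y M) (ℤ.∣⇒∣ᵤ {P} combination)))
    where
    M : ℕ
    M = v + shift ξ
    P : ℤ
    P = + (p ^ M)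
    combination : P ℤ.∣ b ℤ.* defect x y M ℤ.- y ℤ.* defect a b M
    combination = ℤ.∣m∣n⇒∣m-n (ℤ.∣n⇒∣m*n b (ℤ.∣ᵤ⇒∣ {P} hxy)) (ℤ.∣n⇒∣m*n y (ℤ.∣ᵤ⇒∣ {P} hab))

  proportional⇒defects-proportional : ∀ a b x y M → a ℤ.* y ≡ x ℤ.* b →
    ∣ a ∣ * ∣ defect x y M ∣ ≡ ∣ x ∣ * ∣ defect a b M ∣ ×
    ∣ b ∣ * ∣ defect x y M ∣ ≡ ∣ y ∣ * ∣ defect a b M ∣
  proportional⇒defects-proportional a b x y M ay≡xb =
    abs-balance a x (defect x y M) (defect a b M) (+ residue ξ M) (cross-defect′ a b x y M) ,
    abs-balance b y (defect x y M) (defect a b M) (+ (p ^ shift ξ)) (cross-defect a b x y M)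
    where
    abs-balance : ∀ i j m n k → i ℤ.* m ℤ.- j ℤ.* n ≡ k ℤ.* (a ℤ.* y ℤ.- x ℤ.* b) →
      ∣ i ∣ * ∣ m ∣ ≡ ∣ j ∣ * ∣ n ∣
    abs-balance i j m n k eq = begin
      ∣ i ∣ * ∣ m ∣   ≡⟨ ℤ.abs-* i m ⟨
      ∣ i ℤ.* m ∣     ≡⟨ cong ∣_∣ (ℤ.i-j≡0⇒i≡j (i ℤ.* m) (j ℤ.* n) im-jn≡0) ⟩
      ∣ j ℤ.* n ∣     ≡⟨ ℤ.abs-* j n ⟩
      ∣ j ∣ * ∣ n ∣   ∎
      where
      open ≡-Reasoning
      im-jn≡0 : i ℤ.* m ℤ.- j ℤ.* n ≡ ℤ.0ℤ
      im-jn≡0 = trans eq (trans (cong (k ℤ.*_) (ℤ.i≡j⇒i-j≡0 ay≡xb)) (ℤ.*-zeroʳ k))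

module _ {p : ℕ} (p-prime : Prime p) (ξ : Qp p) where

  private instance
    p≢0 : NonZero p
    p≢0 = prime⇒nonZero p-prime

  proportional⇒p^k∣ : ∀ a b x y {w} k → a ℤ.* y ≡ x ℤ.* b →
    ValGe ξ a b w → ¬ ValGe ξ a b (suc w) → ValGe ξ x y (w + k) →
    (p ^ k ∣ ∣ x ∣) × (p ^ k ∣ ∣ y ∣)
  proportional⇒p^k∣ a b x y {w} k ay≡xb hab ¬hab hxy =
    divides-factor x (∣ a ∣) (proj₁ balance) , divides-factor y (∣ b ∣) (proj₂ balance)
    where
    s : ℕ
    s = shift ξ
    M : ℕ
    M = suc (w + k) + s
    balance : ∣ a ∣ * ∣ defect ξ x y M ∣ ≡ ∣ x ∣ * ∣ defect ξ a b M ∣ ×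
              ∣ b ∣ * ∣ defect ξ x y M ∣ ≡ ∣ y ∣ * ∣ defect ξ a b M ∣
    balance = proportional⇒defects-proportional ξ a b x y M ay≡xb
    p^[w+s]∣ab : p ^ (w + s) ∣ ∣ defect ξ a b M ∣
    p^[w+s]∣ab = Equivalence.to (ValGe⇔∣defect ξ a b (+-monoˡ-≤ s (m≤n⇒m≤1+n (m≤m+n w k)))) hab
    p^[1+w+s]∤ab : ¬ p ^ suc (w + s) ∣ ∣ defect ξ a b M ∣
    p^[1+w+s]∤ab h = ¬hab (Equivalence.from (ValGe⇔∣defect ξ a b (+-monoˡ-≤ s (s≤s (m≤m+n w k)))) h)
    p^[w+s+k]∣xy : p ^ (w + s + k) ∣ ∣ defect ξ x y M ∣
    p^[w+s+k]∣xy = subst (λ e → p ^ e ∣ ∣ defect ξ x y M ∣) (swap w k s)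
      (Equivalence.to (ValGe⇔∣defect ξ x y (+-monoˡ-≤ s (n≤1+n (w + k)))) hxy)
      where
      swap : ∀ w k s → w + k + s ≡ w + s + k
      swap = solve-∀
    divides-factor : ∀ u c → c * ∣ defect ξ x y M ∣ ≡ ∣ u ∣ * ∣ defect ξ a b M ∣ → p ^ k ∣ ∣ u ∣
    divides-factor u c eq = p^[k+j]∣m*n⇒p^j∣m p-prime (w + s) k ∣ u ∣ p^[w+s]∣ab p^[1+w+s]∤ab
      (subst (p ^ (w + s + k) ∣_) eq (∣n⇒∣m*n c p^[w+s+k]∣xy))

  nonproportional⇒p^w≤ : ∀ a b x y {w} → a ℤ.* y ≢ x ℤ.* b →
    ValGe ξ a b w → ValGe ξ x y w → 0 < ∣ x ℤ.* y ∣ →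
    p ^ w ≤ 2 * (∣ a ∣ ⊔ ∣ b ∣) * ∣ x ℤ.* y ∣
  nonproportional⇒p^w≤ a b x y {w} ay≢xb hab hxy 0<xy = begin
    p ^ w                              ≤⟨ ∣⇒≤ {{D≢0}} (ValGe⇒p^v∣cross ξ a b x y {w} hab hxy) ⟩
    ∣ a ℤ.* y ℤ.- x ℤ.* b ∣            ≤⟨ ℤ.∣i-j∣≤∣i∣+∣j∣ (a ℤ.* y) (x ℤ.* b) ⟩
    ∣ a ℤ.* y ∣ + ∣ x ℤ.* b ∣          ≡⟨ cong₂ _+_ (ℤ.abs-* a y) (ℤ.abs-* x b) ⟩
    ∣ a ∣ * ∣ y ∣ + ∣ x ∣ * ∣ b ∣      ≤⟨ +-mono-≤ (*-mono-≤ (m≤m⊔n ∣ a ∣ ∣ b ∣) y≤P)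
                                                    (*-mono-≤ x≤P (m≤n⊔m ∣ a ∣ ∣ b ∣)) ⟩
    H * P + P * H                      ≡⟨ double H P ⟩
    2 * H * P                          ≡⟨ cong (2 * H *_) (ℤ.abs-* x y) ⟨
    2 * H * ∣ x ℤ.* y ∣                ∎
    where
    open ≤-Reasoning
    H : ℕ
    H = ∣ a ∣ ⊔ ∣ b ∣
    P : ℕ
    P = ∣ x ∣ * ∣ y ∣
    D≢0 : NonZero ∣ a ℤ.* y ℤ.- x ℤ.* b ∣
    D≢0 = ≢-nonZero (λ D≡0 → ay≢xb (ℤ.i-j≡0⇒i≡j _ _ (ℤ.∣i∣≡0⇒i≡0 D≡0)))
    instance
      P≢0 : NonZero P
      P≢0 = >-nonZero (subst (0 <_) (ℤ.abs-* x y) 0<xy)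
    y≤P : ∣ y ∣ ≤ P
    y≤P = m≤n*m ∣ y ∣ ∣ x ∣ {{m*n≢0⇒m≢0 ∣ x ∣}}
    x≤P : ∣ x ∣ ≤ P
    x≤P = m≤m*n ∣ x ∣ ∣ y ∣ {{m*n≢0⇒n≢0 ∣ x ∣}}
    double : ∀ H P → H * P + P * H ≡ 2 * H * P
    double = solve-∀

  approximation-gap : ∀ a b x y {w} k → ValGe ξ a b w → ¬ ValGe ξ a b (suc w) →
    ValGe ξ x y (w + suc k) → 0 < ∣ x ℤ.* y ∣ → ∣ x ℤ.* y ∣ ≤ p ^ k * p ^ k →
    p ^ w ≤ 2 * (∣ a ∣ ⊔ ∣ b ∣) * (p ^ k * p ^ k)
  approximation-gap a b x y {w} k hab ¬hab hxy 0<xy xy≤p^2k with a ℤ.* y ℤ.≟ x ℤ.* b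
  ... | no ay≢xb = ≤-trans
    (nonproportional⇒p^w≤ a b x y {w} ay≢xb hab (ValGe-mono ξ x y (m≤m+n w (suc k)) hxy) 0<xy)
    (*-monoʳ-≤ (2 * (∣ a ∣ ⊔ ∣ b ∣)) xy≤p^2k)
  ... | yes ay≡xb = ⊥-elim (<⇒≱ p^2k<∣xy∣ xy≤p^2k)
    where
    open ≤-Reasoning
    instance
      xy≢0 : NonZero (∣ x ∣ * ∣ y ∣)
      xy≢0 = >-nonZero (subst (0 <_) (ℤ.abs-* x y) 0<xy)
    p^[1+k]∣ : (p ^ suc k ∣ ∣ x ∣) × (p ^ suc k ∣ ∣ y ∣)
    p^[1+k]∣ = proportional⇒p^k∣ a b x y (suc k) ay≡xb hab ¬hab hxy
    p^k<p^[1+k] : p ^ k < p ^ suc k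
    p^k<p^[1+k] = ^-monoʳ-< p (nonTrivial⇒n>1 p {{prime⇒nonTrivial p-prime}}) (n<1+n k)
    p^2k<∣xy∣ : p ^ k * p ^ k < ∣ x ℤ.* y ∣
    p^2k<∣xy∣ = begin-strict
      p ^ k * p ^ k                <⟨ *-mono-< p^k<p^[1+k] p^k<p^[1+k] ⟩
      p ^ suc k * p ^ suc k        ≤⟨ *-mono-≤ (∣⇒≤ {{m*n≢0⇒m≢0 ∣ x ∣}} (proj₁ p^[1+k]∣))
                                               (∣⇒≤ {{m*n≢0⇒n≢0 ∣ x ∣}} (proj₂ p^[1+k]∣)) ⟩
      ∣ x ∣ * ∣ y ∣                ≡⟨ ℤ.abs-* x y ⟨
      ∣ x ℤ.* y ∣                  ∎

unitPairs : List (ℤ × ℤ)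
unitPairs = (+ 1 , + 1) ∷ (+ 1 , -[1+ 0 ]) ∷ (-[1+ 0 ] , + 1) ∷ (-[1+ 0 ] , -[1+ 0 ]) ∷ []

∉unitPairs⇒1<∣a∣⊔∣b∣ : ∀ a b → a ≢ + 0 → b ≢ + 0 → (a , b) ∉ unitPairs → 1 < ∣ a ∣ ⊔ ∣ b ∣
∉unitPairs⇒1<∣a∣⊔∣b∣ (+ 0) b a≢0 _ _ = ⊥-elim (a≢0 refl)
∉unitPairs⇒1<∣a∣⊔∣b∣ a (+ 0) _ b≢0 _ = ⊥-elim (b≢0 refl)
∉unitPairs⇒1<∣a∣⊔∣b∣ (+ suc (suc m)) b _ _ _ = ≤-trans (s≤s (s≤s z≤n)) (m≤m⊔n _ ∣ b ∣)
∉unitPairs⇒1<∣a∣⊔∣b∣ -[1+ suc m ] b _ _ _ = ≤-trans (s≤s (s≤s z≤n)) (m≤m⊔n _ ∣ b ∣)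
∉unitPairs⇒1<∣a∣⊔∣b∣ a (+ suc (suc n)) _ _ _ = ≤-trans (s≤s (s≤s z≤n)) (m≤n⊔m ∣ a ∣ _)
∉unitPairs⇒1<∣a∣⊔∣b∣ a -[1+ suc n ] _ _ _ = ≤-trans (s≤s (s≤s z≤n)) (m≤n⊔m ∣ a ∣ _)
∉unitPairs⇒1<∣a∣⊔∣b∣ (+ 1) (+ 1) _ _ ∉ = ⊥-elim (∉ (here refl))
∉unitPairs⇒1<∣a∣⊔∣b∣ (+ 1) -[1+ 0 ] _ _ ∉ = ⊥-elim (∉ (there (here refl)))
∉unitPairs⇒1<∣a∣⊔∣b∣ -[1+ 0 ] (+ 1) _ _ ∉ = ⊥-elim (∉ (there (there (here refl))))
∉unitPairs⇒1<∣a∣⊔∣b∣ -[1+ 0 ] -[1+ 0 ] _ _ ∉ = ⊥-elim (∉ (there (there (there (here refl)))))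

module Scale (d : ℕ) where

  -- 3 * d < c means c ≥ d + T.
  T : ℕ
  T = suc (d + d)

  -- Large enough that H ^ liouvilleExponent p X₀ ≤ p ^ w gives both (2 H p²) ^ T < p ^ w,
  -- via 2 H p² ≤ H ^ (2 + 2p), and X₀ * T ≤ w, via p ≤ H ^ p.
  liouvilleExponent : ℕ → ℕ → ℕ
  liouvilleExponent p X₀ = suc ((2 + p + p) * T) + p * (X₀ * T)

  module _ {p H : ℕ} (X₀ w : ℕ) (1<p : 1 < p) (1<H : 1 < H)
           (H^μ≤p^w : H ^ liouvilleExponent p X₀ ≤ p ^ w) where

    private
      p≤H^p : p ≤ H ^ p
      p≤H^p = ≤-trans (<⇒≤ (n<m^n ≤-refl p)) (^-monoˡ-≤ p 1<H)

      H^≤p^w : ∀ {m} → m ≤ liouvilleExponent p X₀ → H ^ m ≤ p ^ w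
      H^≤p^w m≤μ = ≤-trans (^-monoʳ-≤ H {{>-nonZero (<-trans z<s 1<H)}} m≤μ) H^μ≤p^w

    [2Hp²]^T<p^w : (2 * H * (p * p)) ^ T < p ^ w
    [2Hp²]^T<p^w = begin-strict
      (2 * H * (p * p)) ^ T        ≤⟨ ^-monoˡ-≤ T 2Hp²≤ ⟩
      (H ^ (2 + p + p)) ^ T        ≡⟨ ^-*-assoc H (2 + p + p) T ⟩
      H ^ ((2 + p + p) * T)        <⟨ ^-monoʳ-< H 1<H (n<1+n ((2 + p + p) * T)) ⟩
      H ^ suc ((2 + p + p) * T)    ≤⟨ H^≤p^w (m≤m+n (suc ((2 + p + p) * T)) (p * (X₀ * T))) ⟩
      p ^ w                        ∎
      where
      open ≤-Reasoning
      2Hp²≤ : 2 * H * (p * p) ≤ H ^ (2 + p + p)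
      2Hp²≤ = begin
        2 * H * (p * p)            ≤⟨ *-mono-≤ (*-monoˡ-≤ H 1<H) (*-mono-≤ p≤H^p p≤H^p) ⟩
        H * H * (H ^ p * H ^ p)    ≡⟨ cong (H * H *_) (^-distribˡ-+-* H p p) ⟨
        H * H * H ^ (p + p)        ≡⟨ *-assoc H H _ ⟩
        H ^ (2 + p + p)            ∎

    X₀*T≤w : X₀ * T ≤ w
    X₀*T≤w = ^-cancelˡ-≤ 1<p (begin
      p ^ (X₀ * T)                 ≤⟨ ^-monoˡ-≤ (X₀ * T) p≤H^p ⟩
      (H ^ p) ^ (X₀ * T)           ≡⟨ ^-*-assoc H p (X₀ * T) ⟩
      H ^ (p * (X₀ * T))           ≤⟨ H^≤p^w (m≤n+m (p * (X₀ * T)) (suc ((2 + p + p) * T))) ⟩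
      p ^ w                        ∎)
      where open ≤-Reasoning

  module _ (w : ℕ) where

    -- The least K with w * d < K * T: large enough for K-excess, small enough for
    -- C*p^K*p^K<p^w.
    q : ℕ
    q = w * d / T

    K : ℕ
    K = suc q

    w*d<K*T : w * d < K * T
    w*d<K*T = begin-strict
      w * d                        ≡⟨ m≡m%n+[m/n]*n (w * d) T ⟩
      (w * d) % T + q * T          <⟨ +-monoˡ-< (q * T) (m%n<n (w * d) T) ⟩
      K * T                        ∎
      where open ≤-Reasoning

    K-excess : ∀ {c} → 3 * d < c → w * d + K * d < K * c
    K-excess {c} 3d<c = begin-strict
      w * d + K * d                <⟨ +-monoˡ-< (K * d) w*d<K*T ⟩
      K * T + K * d                ≡⟨ distrib K d ⟩
      K * suc (3 * d)              ≤⟨ *-monoʳ-≤ K 3d<c ⟩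
      K * c                        ∎
      where
      open ≤-Reasoning
      distrib : ∀ K d → K * suc (d + d) + K * d ≡ K * suc (3 * d)
      distrib = solve-∀

    X₀≤p^K : ∀ {p X₀} → 1 < p → 0 < d → X₀ * T ≤ w → X₀ ≤ p ^ K
    X₀≤p^K {p} {X₀} 1<p 0<d X₀*T≤w = <⇒≤ (<-trans X₀<K (n<m^n 1<p K))
      where
      open ≤-Reasoning
      X₀<K : X₀ < K
      X₀<K = *-cancelʳ-< T X₀ K (begin-strict
        X₀ * T                     ≤⟨ X₀*T≤w ⟩
        w                          ≤⟨ m≤m*n w d {{>-nonZero 0<d}} ⟩
        w * d                      <⟨ w*d<K*T ⟩
        K * T                      ∎)

    C*p^K*p^K<p^w : ∀ {p} .{{_ : NonZero p}} C → (C * (p * p)) ^ T < p ^ w →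
      C * (p ^ K * p ^ K) < p ^ w
    C*p^K*p^K<p^w {p} C [Cp²]^T<p^w = ^-cancelʳ-< T (begin-strict
      (C * (p ^ K * p ^ K)) ^ T             ≡⟨ cong (_^ T) (regroup C p (p ^ q)) ⟩
      (Cp² * (p ^ q * p ^ q)) ^ T           ≡⟨ distrib Cp² (p ^ q) ⟩
      Cp² ^ T * ((p ^ q) ^ T * (p ^ q) ^ T) ≤⟨ *-monoʳ-≤ (Cp² ^ T) (*-mono-≤ p^qT≤P p^qT≤P) ⟩
      Cp² ^ T * (P * P)                     <⟨ *-monoˡ-< (P * P) {{m*n≢0 P P}} [Cp²]^T<p^w ⟩
      p ^ w * (P * P)                       ≡⟨ p^w*P*P≡[p^w]^T ⟩
      (p ^ w) ^ T                           ∎)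
      where
      open ≤-Reasoning
      Cp² : ℕ
      Cp² = C * (p * p)
      P : ℕ
      P = p ^ (w * d)
      instance
        P≢0 : NonZero P
        P≢0 = m^n≢0 p (w * d)
      regroup : ∀ C p Q → C * (p * Q * (p * Q)) ≡ C * (p * p) * (Q * Q)
      regroup = solve-∀
      distrib : ∀ A Q → (A * (Q * Q)) ^ T ≡ A ^ T * (Q ^ T * Q ^ T)
      distrib A Q = trans (^-distribʳ-* A (Q * Q) T) (cong (A ^ T *_) (^-distribʳ-* Q Q T))
      p^qT≤P : (p ^ q) ^ T ≤ P
      p^qT≤P = subst (_≤ P) (sym (^-*-assoc p q T)) (^-monoʳ-≤ p (m/n*n≤m (w * d) T))
      expand : ∀ w d → w * suc (d + d) ≡ w + (w * d + w * d)
      expand = solve-∀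
      p^w*P*P≡[p^w]^T : p ^ w * (P * P) ≡ (p ^ w) ^ T
      p^w*P*P≡[p^w]^T = begin-equality
        p ^ w * (P * P)                     ≡⟨ cong (p ^ w *_) (^-distribˡ-+-* p (w * d) (w * d)) ⟨
        p ^ w * p ^ (w * d + w * d)         ≡⟨ ^-distribˡ-+-* p w (w * d + w * d) ⟨
        p ^ (w + (w * d + w * d))           ≡⟨ cong (p ^_) (expand w d) ⟨
        p ^ (w * T)                         ≡⟨ ^-*-assoc p w T ⟨
        (p ^ w) ^ T                         ∎

corollary3p2 : ∀ (p : ℕ) → Prime p → (ξ : Qp p) → PadicLiouville ξ →
    ∀ (c d : ℕ) → 3 * suc d < c → ¬ HatMuTimesAdmissible ξ c (suc d)
corollary3p2 p p-prime ξ (_ , liouville) c d 3d<c adm@(X₀ , _)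
  with liouville (Scale.liouvilleExponent (suc d) p X₀) unitPairs
... | a , b , ∉units , sol@(a≢0 , b≢0 , _) =
  LiouvilleSol⇒exact-valuation ξ (liouvilleExponent p X₀) a b sol λ (w , H^μ≤p^w , hab , ¬hab) →
    let 1<H = ∉unitPairs⇒1<∣a∣⊔∣b∣ a b a≢0 b≢0 ∉units
        (x , y , 0<xy , xy≤p^2K , hxy) = admissible-at-p^K ξ 1<p adm (K w) w
          (X₀≤p^K w 1<p z<s (X₀*T≤w X₀ w 1<p 1<H H^μ≤p^w)) (K-excess w 3d<c)
    in <⇒≱ (C*p^K*p^K<p^w w (2 * (∣ a ∣ ⊔ ∣ b ∣)) ([2Hp²]^T<p^w X₀ w 1<p 1<H H^μ≤p^w))
           (approximation-gap p-prime ξ a b x y {w} (K w) hab ¬hab hxy 0<xy xy≤p^2K)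
  where
  open Scale (suc d)
  instance
    p≢0 : NonZero p
    p≢0 = prime⇒nonZero p-prime
  1<p : 1 < p
  1<p = nonTrivial⇒n>1 p {{prime⇒nonTrivial p-prime}}
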